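{- Let $k\ge 0$. A $k$-spanner $G$ has a perfect matching, and $\nu(G)=k+5$.
   Context: All graphs are finite, simple, undirected and loopless. $\nu(G)$ is the maximum size of a matching in $G$. A leg attached at a vertex $c$ is a path $c\,x\,y$ with $x,y$ new vertices. For an integer $k\ge 0$, a $k$-spanner is the tree obtained from two vertices $c_1,c_2$ (the central vertices) joined by an edge, by attaching $p\ge 2$ legs at $c_1$ and $q\ge 2$ legs at $c_2$, with $p+q=k+4$ (all leg vertices distinct). -}

module Defs where

open import Data.Nat using (ℕ; zero; suc; _+_; _*_; _≤_; _<_; z≤n; s≤s)
open import Data.Nat.Properties using (<-irrefl; n<1+n; ≤-refl)
open import Data.Fin using (Fin; toℕ)
open import Data.Product using (Σ; _×_; _,_; proj₁; proj₂; ∃-syntax)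
open import Data.Sum using (_⊎_; inj₁; inj₂)
open import Data.List using (List; []; _∷_; length; concatMap)
open import Data.List.Relation.Unary.All using (All)
open import Data.List.Relation.Unary.Unique.Propositional using (Unique)
open import Data.List.Membership.Propositional using (_∈_)
open import Relation.Nullary using (¬_)
open import Relation.Binary.PropositionalEquality using (_≡_; refl; subst)
open import Function.Bundles using (_⤖_; Bijection; _⇔_)

record Graph (n : ℕ) : Set₁ where
  field
    Adj    : Fin n → Fin n → Set
    sym    : ∀ u v → Adj u v → Adj v u
    irrefl : ∀ v → ¬ Adj v v
open Graph public

endpoints : ∀ {n} → List (Fin n × Fin n) → List (Fin n)
endpoints = concatMap (λ e → proj₁ e ∷ proj₂ e ∷ [])

record Matching {n : ℕ} (G : Graph n) : Set where
  field
    edges    : List (Fin n × Fin n)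
    areEdges : All (λ e → Adj G (proj₁ e) (proj₂ e)) edges
    disjoint : Unique (endpoints edges)
open Matching public

size : ∀ {n} {G : Graph n} → Matching G → ℕ
size M = length (edges M)

IsPerfect : ∀ {n} {G : Graph n} → Matching G → Set
IsPerfect {n} M = ∀ (v : Fin n) → v ∈ endpoints (edges M)

HasPerfectMatching : ∀ {n} → Graph n → Set
HasPerfectMatching G = Σ (Matching G) IsPerfect

MatchingNumberIs : ∀ {n} → Graph n → ℕ → Set
MatchingNumberIs G m =
  (Σ (Matching G) λ M → size M ≡ m) × (∀ (M : Matching G) → size M ≤ m)

_≅_ : ∀ {m n} → Graph m → Graph n → Set
_≅_ {m} {n} G H = Σ (Fin m ⤖ Fin n) λ f →
  ∀ u v → Adj G u v ⇔ Adj H (Bijection.to f u) (Bijection.to f v)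

-- The model spanner with p legs at c₁ and q legs at c₂.
-- Vertices 0..(2 + 2(p+q) - 1):  0 = c₁, 1 = c₂,
-- leg number i (i < p+q) is the path  c (2+2i) (3+2i),
-- attached at c₁ if i < p and at c₂ (i = p + j, j < q) otherwise.

data Arc (p q : ℕ) : ℕ → ℕ → Set where
  central : Arc p q 0 1
  leg₁    : ∀ i → i < p → Arc p q 0 (2 + 2 * i)
  leg₂    : ∀ j → j < q → Arc p q 1 (2 + 2 * (p + j))
  tip     : ∀ i → i < p + q → Arc p q (2 + 2 * i) (3 + 2 * i)

Arc-< : ∀ {p q a b} → Arc p q a b → a < b
Arc-< central = s≤s z≤n
Arc-< (leg₁ i _) = s≤s z≤n
Arc-< (leg₂ j _) = s≤s (s≤s z≤n)
Arc-< (tip i _) = n<1+n _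

SpannerAdj : ∀ p q → Fin (2 + 2 * (p + q)) → Fin (2 + 2 * (p + q)) → Set
SpannerAdj p q u v = Arc p q (toℕ u) (toℕ v) ⊎ Arc p q (toℕ v) (toℕ u)

Spanner : ∀ p q → Graph (2 + 2 * (p + q))
Spanner p q = record
  { Adj    = SpannerAdj p q
  ; sym    = λ { u v (inj₁ a) → inj₂ a ; u v (inj₂ a) → inj₁ a }
  ; irrefl = λ { v (inj₁ a) → <-irrefl refl (Arc-< a)
               ; v (inj₂ a) → <-irrefl refl (Arc-< a) }
  }

IsSpanner : ∀ {n} → ℕ → Graph n → Set
IsSpanner k G = ∃[ p ] ∃[ q ] (2 ≤ p × 2 ≤ q × p + q ≡ k + 4 × Spanner p q ≅ G)

module Submission where

-- A k-spanner has 2 + 2(p + q) = 2(k + 5) vertices, and listing them in the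
-- order c₁, c₂, then leg by leg (inner vertex, outer vertex), every two
-- consecutive vertices are adjacent: c₁c₂ is the central edge and each leg
-- contributes its tip edge.  Pairing up this list therefore gives a perfect
-- matching of size k + 5.  No matching can be larger, because in any graph
-- on n vertices the 2·|M| endpoints of a matching M are distinct vertices,
-- so 2·|M| ≤ n, with equality exactly when M is perfect.

open import Defs hiding (sym)
open import Data.Nat using (ℕ; zero; suc; _+_; _*_; _≤_; _<_; z≤n; s≤s)
open import Data.Nat.Properties
  using (*-suc; *-cancelˡ-≡; *-cancelˡ-≤; ≤-antisym; ≤-trans; ≤-reflexive; +-suc; suc-injective)
open import Data.Fin using (Fin; toℕ) renaming (zero to fzero; suc to fsuc)
open import Data.Fin.Properties using (injective⇒≤)
open import Data.Product using (_×_; _,_; proj₁; proj₂)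
open import Data.Sum using (inj₁)
open import Data.List using (List; []; _∷_; length; map; lookup; tabulate; allFin; applyUpTo; upTo)
open import Data.List.Properties using (length-map; length-tabulate; map-tabulate)
open import Data.List.Relation.Unary.All as All using (All; []; _∷_)
import Data.List.Relation.Unary.All.Properties as All
open import Data.List.Relation.Unary.Any using (index)
open import Data.List.Relation.Unary.Any.Properties using (lookup-index)
open import Data.List.Relation.Unary.AllPairs using (_∷_)
open import Data.List.Relation.Unary.Unique.Propositional using (Unique)
import Data.List.Relation.Unary.Unique.Propositional.Properties as Unique
open import Data.List.Membership.Propositional using (_∈_)
open import Data.List.Membership.Propositional.Properties using (∈-lookup; ∈-allFin; ∈-map⁺)
open import Relation.Binary.PropositionalEquality
  using (_≡_; refl; sym; trans; cong; subst; module ≡-Reasoning)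
open import Function.Bundles using (Bijection; Equivalence)
open import Data.Empty using (⊥-elim)

lookup-injective : ∀ {A : Set} {xs : List A} → Unique xs →
                   ∀ {i j} → lookup xs i ≡ lookup xs j → i ≡ j
lookup-injective (_ ∷ _)       {fzero}  {fzero}  _  = refl
lookup-injective (x≢xs ∷ _)    {fzero}  {fsuc j} eq = ⊥-elim (All.lookup x≢xs (∈-lookup j) eq)
lookup-injective (x≢xs ∷ _)    {fsuc i} {fzero}  eq = ⊥-elim (All.lookup x≢xs (∈-lookup i) (sym eq))
lookup-injective (_ ∷ unique)  {fsuc i} {fsuc j} eq = cong fsuc (lookup-injective unique eq)

unique⇒length≤ : ∀ {n} {xs : List (Fin n)} → Unique xs → length xs ≤ n
unique⇒length≤ unique = injective⇒≤ (lookup-injective unique)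

-- A list containing every element of Fin n has at least n entries:
-- sending each element to a position where it occurs is injective.
covering⇒length≥ : ∀ {n} {xs : List (Fin n)} → (∀ v → v ∈ xs) → n ≤ length xs
covering⇒length≥ {xs = xs} covers = injective⇒≤ position-injective
  where
  position-injective : ∀ {u v} → index (covers u) ≡ index (covers v) → u ≡ v
  position-injective {u} {v} eq = begin
    u                            ≡⟨ lookup-index (covers u) ⟩
    lookup xs (index (covers u)) ≡⟨ cong (lookup xs) eq ⟩
    lookup xs (index (covers v)) ≡⟨ sym (lookup-index (covers v)) ⟩
    v                            ∎
    where open ≡-Reasoning

length-endpoints : ∀ {n} (es : List (Fin n × Fin n)) → length (endpoints es) ≡ 2 * length es
length-endpoints []       = refl
length-endpoints (_ ∷ es) = trans (cong (2 +_) (length-endpoints es)) (sym (*-suc 2 (length es)))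

matching-bound : ∀ {n} {G : Graph n} (M : Matching G) → 2 * size M ≤ n
matching-bound M =
  subst (_≤ _) (length-endpoints (edges M)) (unique⇒length≤ (disjoint M))

perfect-size : ∀ {n} {G : Graph n} (M : Matching G) → IsPerfect M → 2 * size M ≡ n
perfect-size M perfect = trans (sym (length-endpoints (edges M)))
  (≤-antisym (unique⇒length≤ (disjoint M)) (covering⇒length≥ perfect))

perfect⇒maximum : ∀ {n} {G : Graph n} (M : Matching G) → IsPerfect M →
                  MatchingNumberIs G (size M)
perfect⇒maximum M perfect = (M , refl) , λ M′ →
  *-cancelˡ-≤ 2 (≤-trans (matching-bound M′) (≤-reflexive (sym (perfect-size M perfect))))

module Transport {m n} (G : Graph m) (H : Graph n) (iso : G ≅ H) where

  private
    f : Fin m → Fin n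
    f = Bijection.to (proj₁ iso)

    f² : Fin m × Fin m → Fin n × Fin n
    f² (u , v) = f u , f v

  endpoints-map : ∀ (es : List (Fin m × Fin m)) → endpoints (map f² es) ≡ map f (endpoints es)
  endpoints-map []       = refl
  endpoints-map (e ∷ es) = cong (λ rest → f (proj₁ e) ∷ f (proj₂ e) ∷ rest) (endpoints-map es)

  transport : Matching G → Matching H
  transport M = record
    { edges    = map f² (edges M)
    ; areEdges = All.map⁺ (All.map (λ {e} → Equivalence.to (proj₂ iso (proj₁ e) (proj₂ e))) (areEdges M))
    ; disjoint = subst Unique (sym (endpoints-map (edges M)))
                   (Unique.map⁺ (Bijection.injective (proj₁ iso)) (disjoint M))
    }

  transport-size : ∀ M → size (transport M) ≡ size M
  transport-size M = length-map f² (edges M)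

  -- Every vertex of H is the image of a vertex of G, which M covers.
  transport-perfect : ∀ M → IsPerfect M → IsPerfect (transport M)
  transport-perfect M perfect v with Bijection.surjective (proj₁ iso) v
  ... | u , f⁻¹ = subst (v ∈_) (sym (endpoints-map (edges M)))
                    (subst (_∈ map f (endpoints (edges M))) (f⁻¹ refl) (∈-map⁺ f (perfect u)))

pairUp : ∀ {A : Set} → List A → List (A × A)
pairUp (x ∷ y ∷ rest) = (x , y) ∷ pairUp rest
pairUp _              = []

pairUp-map : ∀ {A B : Set} (f : A → B) (xs : List A) →
             pairUp (map f xs) ≡ map (λ e → f (proj₁ e) , f (proj₂ e)) (pairUp xs)
pairUp-map f []             = refl
pairUp-map f (_ ∷ [])       = refl
pairUp-map f (_ ∷ _ ∷ rest) = cong (_ ∷_) (pairUp-map f rest)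

endpoints-pairUp : ∀ {n} (c : ℕ) (xs : List (Fin n)) → length xs ≡ 2 * c →
                   endpoints (pairUp xs) ≡ xs
endpoints-pairUp zero    []             _   = refl
endpoints-pairUp (suc c) (x ∷ y ∷ rest) len =
  cong (λ r → x ∷ y ∷ r)
       (endpoints-pairUp c rest (suc-injective (suc-injective (trans len (*-suc 2 c)))))
endpoints-pairUp (suc c) (_ ∷ [])       len with () ← suc-injective (trans len (*-suc 2 c))

pairUp-applyUpTo : ∀ {A : Set} (P : A × A → Set) (f : ℕ → A) (c : ℕ) →
                   (∀ {i} → i < c → P (f (2 * i) , f (suc (2 * i)))) →
                   All P (pairUp (applyUpTo f (2 * c)))
pairUp-applyUpTo P f zero    _      = []
pairUp-applyUpTo P f (suc c) pairsP =
  subst (λ len → All P (pairUp (applyUpTo f len))) (sym (*-suc 2 c))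
    (pairsP (s≤s z≤n) ∷ pairUp-applyUpTo P (λ i → f (2 + i)) c next)
  where
  next : ∀ {i} → i < c → P (f (2 + 2 * i) , f (3 + 2 * i))
  next {i} i<c = subst (λ j → P (f j , f (suc j))) (*-suc 2 i) (pairsP (s≤s i<c))

tabulate-toℕ : ∀ {A : Set} (n : ℕ) (g : ℕ → A) → tabulate (λ (i : Fin n) → g (toℕ i)) ≡ applyUpTo g n
tabulate-toℕ zero    g = refl
tabulate-toℕ (suc n) g = cong (g 0 ∷_) (tabulate-toℕ n (λ i → g (suc i)))

toℕ-allFin : ∀ n → map toℕ (allFin n) ≡ upTo n
toℕ-allFin n = trans (map-tabulate (λ i → i) toℕ) (tabulate-toℕ n (λ i → i))

module ModelSpanner (p q : ℕ) where

  order : ℕ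
  order = 2 + 2 * (p + q)

  order-even : order ≡ 2 * suc (p + q)
  order-even = sym (*-suc 2 (p + q))

  consecutive-arc : ∀ {i} → i < suc (p + q) → Arc p q (2 * i) (suc (2 * i))
  consecutive-arc {zero}  _         = central
  consecutive-arc {suc i} (s≤s i<n) rewrite *-suc 2 i = tip i i<n

  IsArc : ℕ × ℕ → Set
  IsArc (a , b) = Arc p q a b

  pairs : List (Fin order × Fin order)
  pairs = pairUp (allFin order)

  pairs-adjacent : All (λ e → SpannerAdj p q (proj₁ e) (proj₂ e)) pairs
  pairs-adjacent = All.map inj₁ (All.map⁻ (subst (All IsArc) (pairUp-map toℕ (allFin order)) arcs))
    where
    arcs : All IsArc (pairUp (map toℕ (allFin order)))
    arcs = subst (λ xs → All IsArc (pairUp xs)) (sym (trans (toℕ-allFin order) (cong upTo order-even)))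
             (pairUp-applyUpTo IsArc (λ i → i) (suc (p + q)) consecutive-arc)

  pairs-endpoints : endpoints pairs ≡ allFin order
  pairs-endpoints = endpoints-pairUp (suc (p + q)) (allFin order)
    (trans (length-tabulate (λ i → i)) order-even)

  matching : Matching (Spanner p q)
  matching = record
    { edges    = pairs
    ; areEdges = pairs-adjacent
    ; disjoint = subst Unique (sym pairs-endpoints) (Unique.allFin⁺ order)
    }

  matching-perfect : IsPerfect matching
  matching-perfect v = subst (v ∈_) (sym pairs-endpoints) (∈-allFin v)

  matching-size : size matching ≡ suc (p + q)
  matching-size = *-cancelˡ-≡ (size matching) (suc (p + q)) 2
    (trans (perfect-size matching matching-perfect) order-even)

lemma3p4 : (k n : ℕ) (G : Graph n) → IsSpanner k G →
           HasPerfectMatching G × MatchingNumberIs G (k + 5)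
lemma3p4 k n G (p , q , _ , _ , p+q≡k+4 , iso) =
  (M , M-perfect) , subst (MatchingNumberIs G) M-size (perfect⇒maximum M M-perfect)
  where
  open ModelSpanner p q
  open Transport (Spanner p q) G iso

  M : Matching G
  M = transport matching

  M-perfect : IsPerfect M
  M-perfect = transport-perfect matching matching-perfect

  M-size : size M ≡ k + 5
  M-size = begin
    size M          ≡⟨ transport-size matching ⟩
    size matching   ≡⟨ matching-size ⟩
    suc (p + q)     ≡⟨ cong suc p+q≡k+4 ⟩
    suc (k + 4)     ≡⟨ sym (+-suc k 4) ⟩
    k + 5           ∎
    where open ≡-Reasoning
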